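{- Let $A$ be a poset with a bottom element $\bot$. Then every set $S$ of games over $A$ has a least upper bound with respect to $\le$; that is, there is a game $M$ with $K\le M$ for all $K\in S$, such that $M\le N$ for every game $N$ satisfying $K\le N$ for all $K\in S$.
   Context: Games over a poset $A$: for each $a\in A$, $[a]$ is an atomic game; if $L,R$ are non-empty sets of games, $\{L\mid R\}$ is a composite game with left options the elements of $L$ and right options the elements of $R$; atomic games have no options. Relations $\le,\triangleright$ by mutual recursion: $G\le H$ iff (1) every left option $G^L$ satisfies $G^L\triangleright H$, (2) every right option $H^R$ of $H$ satisfies $G\triangleright H^R$, (3) if $G$ or $H$ is atomic then $G\triangleright H$; $G\triangleright H$ iff (1) some right option $G^R$ of $G$ satisfies $G^R\le H$, or (2) some left option $H^L$ of $H$ satisfies $G\le H^L$, or (3) $G=[a],H=[b]$ are atomic and $a\le b$ in $A$. -}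

module Defs where

open import Level using (Level; _⊔_) renaming (suc to lsuc; zero to lzero)
open import Data.Product using (Σ; ∃; _×_)
open import Data.Sum using (_⊎_)
open import Relation.Binary.Bundles using (Poset)

module Games {c ℓ₁ ℓ₂ : Level} (A : Poset c ℓ₁ ℓ₂) where
  open Poset A using (Carrier) renaming (_≤_ to _≤A_)

  -- Games over the poset A.
  --   atom a           is the atomic game [a]
  --   node gl gr l r   is {L | R}, where L = image of gl : Lix → Game,
  --                    R = image of gr : Rix → Game, and l : Lix, r : Rix
  --                    witness that L and R are non-empty.
  data Game : Set (lsuc lzero ⊔ c) where
    atom : Carrier → Game
    node : {Lix Rix : Set} → (Lix → Game) → (Rix → Game) → Lix → Rix → Game

  mutual
    infix 4 _≤_ _▷_
    _≤_ : Game → Game → Set ℓ₂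
    atom a ≤ atom b = atom a ▷ atom b
    -- G atomic (no left options): clauses (2) and (3)
    atom a ≤ node hl hr l r = (∀ j → atom a ▷ hr j) × (atom a ▷ node hl hr l r)
    -- H atomic (no right options): clauses (1) and (3)
    node gl gr l r ≤ atom b = (∀ i → gl i ▷ atom b) × (node gl gr l r ▷ atom b)
    node gl gr l r ≤ node hl hr l' r' =
      (∀ i → gl i ▷ node hl hr l' r') × (∀ j → node gl gr l r ▷ hr j)

    _▷_ : Game → Game → Set ℓ₂
    atom a ▷ atom b = a ≤A b
    atom a ▷ node hl hr l r = ∃ λ i → atom a ≤ hl i
    node gl gr l r ▷ atom b = ∃ λ j → gr j ≤ atom b
    node gl gr l r ▷ node hl hr l' r' =
      (∃ λ j → gr j ≤ node hl hr l' r') ⊎ (∃ λ i → node gl gr l r ≤ hl i)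

module Submission where

open import Defs
open import Level using (Level)
open import Data.Product using (Σ; _×_; _,_; proj₁; proj₂)
open import Data.Sum using (_⊎_; inj₁; inj₂)
open import Data.Unit using (⊤; tt)
open import Relation.Binary.Bundles using (Poset)
open import Relation.Binary.Definitions using (Minimum)

-- With R = {⊥, S_i | ⊥}, the supremum is M = {⊥, left options of the S_i | R}.
-- R is the least game that every S_i is ▷ of, and an atomic S_i counts as its
-- own left option; ⊥ only serves to make the option sets non-empty.

module _ {c ℓ₁ ℓ₂ : Level} (A : Poset c ℓ₁ ℓ₂) where
  open Games A
  open Poset A using () renaming (_≤_ to _≤A_; refl to ≤A-refl)

  ▷-fromLeft : ∀ G {Lix Rix : Set} (hl : Lix → Game) (hr : Rix → Game) l r i
             → G ≤ hl i → G ▷ node hl hr l r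
  ▷-fromLeft (atom _)       hl hr l r i p = i , p
  ▷-fromLeft (node _ _ _ _) hl hr l r i p = inj₂ (i , p)

  ▷-fromRight : ∀ {Lix Rix : Set} (gl : Lix → Game) (gr : Rix → Game) l r j H
              → gr j ≤ H → node gl gr l r ▷ H
  ▷-fromRight gl gr l r j (atom _)       p = j , p
  ▷-fromRight gl gr l r j (node _ _ _ _) p = inj₁ (j , p)

  ≤-refl : ∀ G → G ≤ G
  ≤-refl (atom _) = ≤A-refl
  ≤-refl (node gl gr l r) =
    (λ i → ▷-fromLeft (gl i) gl gr l r i (≤-refl (gl i))) ,
    (λ j → ▷-fromRight gl gr l r j (gr j) (≤-refl (gr j)))

  -- Clause (3) of ≤ is clause (1) with the atom as its own left option,
  -- dually for right options; this makes ≤ uniform in the atomic cases.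
  LowerIx : Game → Set
  LowerIx (atom _)             = ⊤
  LowerIx (node {Lix} _ _ _ _) = Lix

  lower : (G : Game) → LowerIx G → Game
  lower (atom a)        _ = atom a
  lower (node gl _ _ _) i = gl i

  UpperIx : Game → Set
  UpperIx (atom _)                   = ⊤
  UpperIx (node {Rix = Rix} _ _ _ _) = Rix

  upper : (H : Game) → UpperIx H → Game
  upper (atom b)        _ = atom b
  upper (node _ hr _ _) j = hr j

  ≤-intro : ∀ G H → (∀ k → lower G k ▷ H) → (∀ j → G ▷ upper H j) → G ≤ H
  ≤-intro (atom _)       (atom _)       lo up = lo tt
  ≤-intro (atom _)       (node _ _ _ _) lo up = up , lo tt
  ≤-intro (node _ _ _ _) (atom _)       lo up = lo , up tt
  ≤-intro (node _ _ _ _) (node _ _ _ _) lo up = lo , up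

  ≤-lower : ∀ G H → G ≤ H → ∀ k → lower G k ▷ H
  ≤-lower (atom _)       (atom _)       p _ = p
  ≤-lower (atom _)       (node _ _ _ _) p _ = proj₂ p
  ≤-lower (node _ _ _ _) (atom _)       p   = proj₁ p
  ≤-lower (node _ _ _ _) (node _ _ _ _) p   = proj₁ p

  ≤-upper : ∀ G H → G ≤ H → ∀ j → G ▷ upper H j
  ≤-upper (atom _)       (atom _)       p _ = p
  ≤-upper (atom _)       (node _ _ _ _) p   = proj₁ p
  ≤-upper (node _ _ _ _) (atom _)       p _ = proj₂ p
  ≤-upper (node _ _ _ _) (node _ _ _ _) p   = proj₂ p

  module WithMinimum {bot : Poset.Carrier A} (minimum : Minimum _≤A_ bot) where

    ⊥≤ : ∀ G → atom bot ≤ G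
    ⊥▷ : ∀ G → atom bot ▷ G
    ⊥≤ (atom b)         = minimum b
    ⊥≤ (node hl hr l r) = (λ j → ⊥▷ (hr j)) , (l , ⊥≤ (hl l))
    ⊥▷ (atom b)         = minimum b
    ⊥▷ (node hl hr l r) = l , ⊥≤ (hl l)

    withBot : {J : Set} → (J → Game) → ⊤ ⊎ J → Game
    withBot T (inj₁ _) = atom bot
    withBot T (inj₂ j) = T j

    withBot-▷ : ∀ {J : Set} (T : J → Game) H → (∀ j → T j ▷ H) → ∀ x → withBot T x ▷ H
    withBot-▷ T H T▷H (inj₁ _) = ⊥▷ H
    withBot-▷ T H T▷H (inj₂ j) = T▷H j

    module _ {I : Set} (S : I → Game) where

      cover : Game
      cover = node (withBot S) (λ (_ : ⊤) → atom bot) (inj₁ tt) tt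

      ▷-cover : ∀ i → S i ▷ cover
      ▷-cover i = ▷-fromLeft (S i) (withBot S) _ (inj₁ tt) tt (inj₂ i) (≤-refl (S i))

      cover-least : ∀ H → (∀ i → S i ▷ H) → cover ≤ H
      cover-least H S▷H =
        ≤-intro cover H (withBot-▷ S H S▷H)
          (λ j → ▷-fromRight (withBot S) _ (inj₁ tt) tt tt (upper H j) (⊥≤ (upper H j)))

      lowers : Σ I (λ i → LowerIx (S i)) → Game
      lowers (i , k) = lower (S i) k

      sup : Game
      sup = node (withBot lowers) (λ (_ : ⊤) → cover) (inj₁ tt) tt

      ≤-sup : ∀ i → S i ≤ sup
      ≤-sup i = ≤-intro (S i) sup
        (λ k → ▷-fromLeft (lower (S i) k) (withBot lowers) _ (inj₁ tt) tt
                 (inj₂ (i , k)) (≤-refl (lower (S i) k)))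
        (λ _ → ▷-cover i)

      sup-least : ∀ N → (∀ i → S i ≤ N) → sup ≤ N
      sup-least N S≤N = ≤-intro sup N
        (withBot-▷ lowers N (λ { (i , k) → ≤-lower (S i) N (S≤N i) k }))
        (λ j → ▷-fromRight (withBot lowers) _ (inj₁ tt) tt tt (upper N j)
                 (cover-least (upper N j) (λ i → ≤-upper (S i) N (S≤N i) j)))

proposition4p13 : {c ℓ₁ ℓ₂ : Level} (A : Poset c ℓ₁ ℓ₂) (bot : Poset.Carrier A) → Minimum (Poset._≤_ A) bot
    → (I : Set) (S : I → Games.Game A)
    → Σ (Games.Game A) (λ M → ((i : I) → Games._≤_ A (S i) M)
    × ((N : Games.Game A) → ((i : I) → Games._≤_ A (S i) N) → Games._≤_ A M N))
proposition4p13 A bot minimum I S = sup S , ≤-sup S , sup-least S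
  where open WithMinimum A minimum
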